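{- Let $\mathcal{L}$ be a representably $\Sigma$-additive symmetric monoidal category. Then $(\mathcal{D},\Delta,m_{\mathcal{D}},p_0,c_{\mathcal{D}})$ is a bicommutative bimonoid in $\mathcal{L}$; that is: $(\mathcal{D},\Delta,m_{\mathcal{D}})$ is a commutative monoid, $(\mathcal{D},p_0,c_{\mathcal{D}})$ is a cocommutative comonoid, and $p_0\circ\Delta=\mathrm{id}_1$, $c_{\mathcal{D}}\circ\Delta=(\Delta\otimes\Delta)\circ\lambda_1^{ -1}$, $p_0\circ m_{\mathcal{D}}=\lambda_1\circ(p_0\otimes p_0)$, and $c_{\mathcal{D}}\circ m_{\mathcal{D}}=(m_{\mathcal{D}}\otimes m_{\mathcal{D}})\circ s_{2,3}\circ(c_{\mathcal{D}}\otimes c_{\mathcal{D}})$.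
   Context: $\mathcal{L}$ symmetric monoidal with tensor $\otimes$, unit $1$, unitors $\lambda,\rho$, symmetry $\gamma$; $s_{2,3}:(\mathcal{D}\otimes\mathcal{D})\otimes(\mathcal{D}\otimes\mathcal{D})\to(\mathcal{D}\otimes\mathcal{D})\otimes(\mathcal{D}\otimes\mathcal{D})$ is the canonical isomorphism (built from associators and symmetry) exchanging the two middle factors. Note $\lambda_1=\rho_1$. $\Sigma$-monoid: nonempty set with a partial operation $\Sigma$ on families indexed by at most countable sets (families in the domain are summable) such that every one-element family $x$ is summable with sum $x$ and, for every family $(x_a)_{a\in A}$ and partition $(A_i)_{i\in I}$ of $A$ ($I$ at most countable, parts possibly empty), $\sum_{a\in A}x_a\simeq\sum_{i\in I}\sum_{a\in A_i}x_a$ ($\simeq$: one side defined iff the other is, and equal). The empty sum is $0$. Representably $\Sigma$-additive: $\mathcal{L}$ has the countable product $\mathcal{D}=\mathbin{\&}_{i\in\mathbb{N}}1$ with projections $p_i:\mathcal{D}\to1$, and internal homs $(\mathcal{D}\multimap X,\mathrm{ev})$ for every $X$; put $\mathrm{in}_i=\langle\delta_{ji}\rangle_{j}\in\mathcal{L}(1,\mathcal{D})$ ($\delta_{ji}=\mathrm{id}_1$ if $j=i$, zero morphism otherwise) and $\Delta=\langle\mathrm{id}_1\rangle_{i\in\mathbb{N}}\in\mathcal{L}(1,\mathcal{D})$. Conditions: (RS-epi) $(X\otimes\mathrm{in}_i)_i$ jointly epic for all $X$; (RS-mon) every $\mathcal{L}(X,Y)$ is a $\Sigma$-monoid whose $0$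 is a zero morphism with $f\circ0=0$, $0\circ g=0$, $0\otimes g=0$, $f\otimes 0=0$; (RS-sum) $(f_i)_{i\in\mathbb{N}}$ in $\mathcal{L}(X,Y)$ is summable iff there is $h\in\mathcal{L}(X\otimes\mathcal{D},Y)$ with $h\circ(X\otimes\mathrm{in}_i)\circ\rho_X^{ -1}=f_i$ for all $i$, and then $\sum_i f_i=h\circ(X\otimes\Delta)\circ\rho_X^{ -1}$; (RS-witness) if $(h_a)_{a\in A}$ in $\mathcal{L}(X\otimes\mathcal{D},Y)$ is such that $(h_a\circ(X\otimes\mathrm{in}_j)\circ\rho_X^{ -1})_{(a,j)}$ is summable, then $(h_a)_a$ is summable. Structure: $m_{\mathcal{D}}=\langle\lambda_1\circ(p_i\otimes p_i)\rangle_{i\in\mathbb{N}}\in\mathcal{L}(\mathcal{D}\otimes\mathcal{D},\mathcal{D})$; $c_{\mathcal{D}}\in\mathcal{L}(\mathcal{D},\mathcal{D}\otimes\mathcal{D})$ is the unique morphism with $c_{\mathcal{D}}\circ\mathrm{in}_n=(\sum_{i=0}^{n}\mathrm{in}_i\otimes\mathrm{in}_{n-i})\circ\lambda_1^{ -1}$ for all $n\in\mathbb{N}$ (it exists and is unique under these hypotheses). -}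

module Defs where

open import Level using (Level; _⊔_) renaming (suc to lsuc)
open import Data.Nat using (ℕ; zero; suc; _∸_; _≟_)
open import Data.Fin using (Fin; toℕ)
open import Data.Empty using (⊥)
open import Data.Product using (Σ; Σ-syntax; ∃; _×_; _,_; proj₁; proj₂)
open import Relation.Nullary using (yes; no)
open import Relation.Binary.PropositionalEquality using (_≡_)
open import Function.Definitions using (Injective)

Countable : Set → Set
Countable A = Σ (A → ℕ) (Injective _≡_ _≡_)

-- The partial sum operation is given as a relation
-- HasSum f s  ("the family f is summable with sum s"), which is
-- functional and only holds for families with an at most countable
-- index set.

Part : {A I : Set} → (A → I) → I → Set
Part {A} π i = Σ A (λ a → π a ≡ i)

record IsΣMonoid {ℓ : Level} (X : Set ℓ) : Set (lsuc Level.zero ⊔ lsuc ℓ) where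
  field
    HasSum      : {A : Set} → (A → X) → X → Set ℓ
    index-countable : {A : Set} {f : A → X} {s : X} → HasSum f s → Countable A
    sum-functional  : {A : Set} {f : A → X} {s t : X} →
                      HasSum f s → HasSum f t → s ≡ t
    inhabitant      : X
    singleton       : {A : Set} (f : A → X) (a : A) → (∀ b → b ≡ a) →
                      HasSum f (f a)
    -- partition associativity (Kleene equality, expressed via HasSum)
    partition       : {A I : Set} → Countable A → Countable I →
                      (f : A → X) (π : A → I) (s : X) →
                      (HasSum f s →
                         Σ[ g ∈ (I → X) ]
                           ((∀ i → HasSum (λ (p : Part π i) → f (proj₁ p)) (g i))
                            × HasSum g s))
                      × ((Σ[ g ∈ (I → X) ]
                           ((∀ i → HasSum (λ (p : Part π i) → f (proj₁ p)) (g i))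
                            × HasSum g s)) → HasSum f s)

  Summable : {A : Set} → (A → X) → Set ℓ
  Summable f = ∃ (HasSum f)

record SymmetricMonoidalCategory (o ℓ : Level) : Set (lsuc (o ⊔ ℓ)) where
  infixr 9 _∘_
  infixr 10 _⊗₀_ _⊗₁_
  field
    Obj : Set o
    Hom : Obj → Obj → Set ℓ
    id  : {X : Obj} → Hom X X
    _∘_ : {X Y Z : Obj} → Hom Y Z → Hom X Y → Hom X Z
    identityˡ : {X Y : Obj} {f : Hom X Y} → id ∘ f ≡ f
    identityʳ : {X Y : Obj} {f : Hom X Y} → f ∘ id ≡ f
    assoc     : {W X Y Z : Obj} {f : Hom Y Z} {g : Hom X Y} {h : Hom W X} →
                (f ∘ g) ∘ h ≡ f ∘ (g ∘ h)

    _⊗₀_ : Obj → Obj → Obj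
    _⊗₁_ : {X Y Z W : Obj} → Hom X Y → Hom Z W → Hom (X ⊗₀ Z) (Y ⊗₀ W)
    ⊗-id : {X Y : Obj} → id {X} ⊗₁ id {Y} ≡ id
    ⊗-∘  : {X Y Z X' Y' Z' : Obj} {f : Hom Y Z} {g : Hom X Y}
           {h : Hom Y' Z'} {k : Hom X' Y'} →
           (f ∘ g) ⊗₁ (h ∘ k) ≡ (f ⊗₁ h) ∘ (g ⊗₁ k)

    unit : Obj

    λ⇒ : {X : Obj} → Hom (unit ⊗₀ X) X
    λ⇐ : {X : Obj} → Hom X (unit ⊗₀ X)
    λ-iso₁ : {X : Obj} → λ⇒ {X} ∘ λ⇐ ≡ id
    λ-iso₂ : {X : Obj} → λ⇐ {X} ∘ λ⇒ ≡ id
    λ-natural : {X Y : Obj} {f : Hom X Y} → λ⇒ ∘ (id ⊗₁ f) ≡ f ∘ λ⇒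

    ρ⇒ : {X : Obj} → Hom (X ⊗₀ unit) X
    ρ⇐ : {X : Obj} → Hom X (X ⊗₀ unit)
    ρ-iso₁ : {X : Obj} → ρ⇒ {X} ∘ ρ⇐ ≡ id
    ρ-iso₂ : {X : Obj} → ρ⇐ {X} ∘ ρ⇒ ≡ id
    ρ-natural : {X Y : Obj} {f : Hom X Y} → ρ⇒ ∘ (f ⊗₁ id) ≡ f ∘ ρ⇒

    α⇒ : {X Y Z : Obj} → Hom ((X ⊗₀ Y) ⊗₀ Z) (X ⊗₀ (Y ⊗₀ Z))
    α⇐ : {X Y Z : Obj} → Hom (X ⊗₀ (Y ⊗₀ Z)) ((X ⊗₀ Y) ⊗₀ Z)
    α-iso₁ : {X Y Z : Obj} → α⇒ {X} {Y} {Z} ∘ α⇐ ≡ id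
    α-iso₂ : {X Y Z : Obj} → α⇐ {X} {Y} {Z} ∘ α⇒ ≡ id
    α-natural : {X Y Z X' Y' Z' : Obj}
                {f : Hom X X'} {g : Hom Y Y'} {h : Hom Z Z'} →
                α⇒ ∘ ((f ⊗₁ g) ⊗₁ h) ≡ (f ⊗₁ (g ⊗₁ h)) ∘ α⇒

    γ : {X Y : Obj} → Hom (X ⊗₀ Y) (Y ⊗₀ X)
    γ-natural : {X Y X' Y' : Obj} {f : Hom X X'} {g : Hom Y Y'} →
                γ ∘ (f ⊗₁ g) ≡ (g ⊗₁ f) ∘ γ
    γ-involutive : {X Y : Obj} → γ {Y} {X} ∘ γ {X} {Y} ≡ id

    triangle : {X Y : Obj} →
               (id {X} ⊗₁ λ⇒ {Y}) ∘ α⇒ ≡ ρ⇒ {X} ⊗₁ id {Y}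
    pentagon : {W X Y Z : Obj} →
               (id {W} ⊗₁ α⇒ {X} {Y} {Z}) ∘ α⇒ ∘ (α⇒ ⊗₁ id) ≡ α⇒ ∘ α⇒
    hexagon  : {X Y Z : Obj} →
               α⇒ {Y} {Z} {X} ∘ γ ∘ α⇒ {X} {Y} {Z}
                 ≡ (id ⊗₁ γ) ∘ α⇒ ∘ (γ ⊗₁ id)

  s₂₃ : {A B C E : Obj} → Hom ((A ⊗₀ B) ⊗₀ (C ⊗₀ E)) ((A ⊗₀ C) ⊗₀ (B ⊗₀ E))
  s₂₃ = α⇐ ∘ (id ⊗₁ (α⇒ ∘ (γ ⊗₁ id) ∘ α⇐)) ∘ α⇒

ifEq : {a : Level} {B : Set a} → ℕ → ℕ → B → B → B
ifEq j i x y with j ≟ i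
... | yes _ = x
... | no  _ = y

record RepresentablyΣAdditive {o ℓ : Level}
         (C : SymmetricMonoidalCategory o ℓ) : Set (lsuc (o ⊔ ℓ)) where
  open SymmetricMonoidalCategory C
  field
    ΣHom : (X Y : Obj) → IsΣMonoid (Hom X Y)
    𝟎    : {X Y : Obj} → Hom X Y
    𝟎-empty : {X Y : Obj} → IsΣMonoid.HasSum (ΣHom X Y) {⊥} (λ ()) 𝟎
    𝟎-∘ˡ : {X Y Z : Obj} {f : Hom Y Z} → f ∘ 𝟎 {X} {Y} ≡ 𝟎
    𝟎-∘ʳ : {X Y Z : Obj} {g : Hom X Y} → 𝟎 {Y} {Z} ∘ g ≡ 𝟎
    𝟎-⊗ˡ : {X Y Z W : Obj} {g : Hom Z W} → 𝟎 {X} {Y} ⊗₁ g ≡ 𝟎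
    𝟎-⊗ʳ : {X Y Z W : Obj} {f : Hom X Y} → f ⊗₁ 𝟎 {Z} {W} ≡ 𝟎

    D : Obj
    p : ℕ → Hom D unit
    ⟨_⟩ : {X : Obj} → (ℕ → Hom X unit) → Hom X D
    ⟨⟩-proj : {X : Obj} (f : ℕ → Hom X unit) (i : ℕ) → p i ∘ ⟨ f ⟩ ≡ f i
    ⟨⟩-unique : {X : Obj} (f : ℕ → Hom X unit) (h : Hom X D) →
                (∀ i → p i ∘ h ≡ f i) → h ≡ ⟨ f ⟩

    _⊸_ : Obj → Obj → Obj
    ev  : {X : Obj} → Hom ((D ⊸ X) ⊗₀ D) X
    cur : {Z X : Obj} → Hom (Z ⊗₀ D) X → Hom Z (D ⊸ X)
    cur-β : {Z X : Obj} (f : Hom (Z ⊗₀ D) X) → ev ∘ (cur f ⊗₁ id) ≡ f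
    cur-unique : {Z X : Obj} (f : Hom (Z ⊗₀ D) X) (g : Hom Z (D ⊸ X)) →
                 ev ∘ (g ⊗₁ id) ≡ f → g ≡ cur f

  δ : ℕ → ℕ → Hom unit unit
  δ j i = ifEq j i id 𝟎

  inj : ℕ → Hom unit D
  inj i = ⟨ (λ j → δ j i) ⟩

  Δ : Hom unit D
  Δ = ⟨ (λ _ → id) ⟩

  HasSum : {X Y : Obj} {A : Set} → (A → Hom X Y) → Hom X Y → Set ℓ
  HasSum {X} {Y} = IsΣMonoid.HasSum (ΣHom X Y)

  field
    RS-epi : {X Y : Obj} (f g : Hom (X ⊗₀ D) Y) →
             (∀ i → f ∘ (id ⊗₁ inj i) ≡ g ∘ (id ⊗₁ inj i)) → f ≡ g
    RS-sum⇒ : {X Y : Obj} (f : ℕ → Hom X Y) → ∃ (HasSum f) →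
              Σ[ h ∈ Hom (X ⊗₀ D) Y ] (∀ i → h ∘ (id ⊗₁ inj i) ∘ ρ⇐ ≡ f i)
    RS-sum⇐ : {X Y : Obj} (f : ℕ → Hom X Y) (h : Hom (X ⊗₀ D) Y) →
              (∀ i → h ∘ (id ⊗₁ inj i) ∘ ρ⇐ ≡ f i) →
              HasSum f (h ∘ (id ⊗₁ Δ) ∘ ρ⇐)
    RS-witness : {X Y : Obj} {A : Set} → Countable A →
                 (h : A → Hom (X ⊗₀ D) Y) →
                 ∃ (HasSum (λ (aj : A × ℕ) →
                    h (proj₁ aj) ∘ (id ⊗₁ inj (proj₂ aj)) ∘ ρ⇐)) →
                 ∃ (HasSum h)

  m : Hom (D ⊗₀ D) D
  m = ⟨ (λ i → λ⇒ ∘ (p i ⊗₁ p i)) ⟩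

  IsComultiplication : Hom D (D ⊗₀ D) → Set ℓ
  IsComultiplication c =
    ∀ (n : ℕ) → Σ[ s ∈ Hom (unit ⊗₀ unit) (D ⊗₀ D) ]
      (HasSum (λ (i : Fin (suc n)) → inj (toℕ i) ⊗₁ inj (n ∸ toℕ i)) s
       × c ∘ inj n ≡ s ∘ λ⇐)

record IsBicommutativeBimonoid {o ℓ : Level} (C : SymmetricMonoidalCategory o ℓ)
         (B : SymmetricMonoidalCategory.Obj C)
         (η : SymmetricMonoidalCategory.Hom C (SymmetricMonoidalCategory.unit C) B)
         (μ : SymmetricMonoidalCategory.Hom C
                (SymmetricMonoidalCategory._⊗₀_ C B B) B)
         (ε : SymmetricMonoidalCategory.Hom C B (SymmetricMonoidalCategory.unit C))
         (ν : SymmetricMonoidalCategory.Hom C B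
                (SymmetricMonoidalCategory._⊗₀_ C B B)) : Set ℓ where
  open SymmetricMonoidalCategory C
  field
    μ-unitˡ : μ ∘ (η ⊗₁ id) ≡ λ⇒
    μ-unitʳ : μ ∘ (id ⊗₁ η) ≡ ρ⇒
    μ-assoc : μ ∘ (μ ⊗₁ id) ≡ μ ∘ (id ⊗₁ μ) ∘ α⇒
    μ-comm  : μ ∘ γ ≡ μ
    ν-counitˡ : (ε ⊗₁ id) ∘ ν ≡ λ⇐
    ν-counitʳ : (id ⊗₁ ε) ∘ ν ≡ ρ⇐
    ν-coassoc : α⇒ ∘ (ν ⊗₁ id) ∘ ν ≡ (id ⊗₁ ν) ∘ ν
    ν-cocomm  : γ ∘ ν ≡ ν
    ε-η : ε ∘ η ≡ id
    ν-η : ν ∘ η ≡ (η ⊗₁ η) ∘ λ⇐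
    ε-μ : ε ∘ μ ≡ λ⇒ ∘ (ε ⊗₁ ε)
    ν-μ : ν ∘ μ ≡ (μ ⊗₁ μ) ∘ s₂₃ ∘ (ν ⊗₁ ν)

-- D = &ᵢ 1 behaves like the algebra of scalar sequences: m is the pointwise product with unit
-- Δ = (1, 1, …), and c is the convolution coproduct c (inₙ) = Σ_{a + b = n} inₐ ⊗ in_b with counit p₀.
-- The monoid laws hold coordinatewise, where they are the laws of (1, id, λ₁); these need the unit
-- coherences λ₁ = ρ₁ and γ₁₁ = id. Morphisms out of D and D ⊗ D are determined on the inₙ and inₐ ⊗ in_b,
-- and composing or tensoring with a fixed morphism commutes with finite sums (pad the family by zeros and
-- act on its witness). Each remaining law thereby becomes an identity between sums over antidiagonals
-- {a + b = n}: a reindexing along a bijection (swap, reassociation, Σₙ {a + b = n} ≅ ℕ × ℕ), a sum with a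
-- single non-zero term, or a sum of zeros, using m ∘ (inₐ ⊗ in_b) = δ_ab inₐ ∘ λ₁.

module Submission where

open import Defs
open import Level using (Level)
open import Axiom.UniquenessOfIdentityProofs.WithK using (uip)
open import Data.Empty using (⊥; ⊥-elim)
open import Data.Nat using (ℕ; zero; suc; _+_; _∸_; _<_; _≤_; _≤?_; _≟_; z≤n; s≤s)
open import Data.Nat.Properties
open import Data.Fin using (Fin; toℕ; fromℕ<)
open import Data.Fin.Properties using (toℕ-fromℕ<; fromℕ<-toℕ; toℕ≤pred[n])
open import Function.Definitions using (Injective)
open import Data.Product using (Σ; Σ-syntax; _×_; _,_; proj₁; proj₂)
open import Function using (_∘′_)
open import Function.Bundles using (_↔_; Inverse; mk↔ₛ′)
open import Function.Construct.Identity using (↔-id)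
open import Relation.Binary.Definitions using (tri<; tri≈; tri>)
open import Relation.Binary.PropositionalEquality
open import Relation.Nullary using (¬_; Dec; yes; no)

module CantorPairing where

  triangular : ℕ → ℕ
  triangular zero    = zero
  triangular (suc k) = suc k + triangular k

  pair : ℕ → ℕ → ℕ
  pair a b = a + triangular (a + b)

  private
    triangular-monotone : ∀ {m n} → m ≤ n → triangular m ≤ triangular n
    triangular-monotone {zero}          _         = z≤n
    triangular-monotone {suc m} {suc n} (s≤s m≤n) = +-mono-≤ (s≤s m≤n) (triangular-monotone m≤n)

    -- pair a b lies in [T (a + b), T (a + b + 1)) for T = triangular, so it determines a + b
    pair-between : ∀ a b → triangular (a + b) ≤ pair a b × pair a b < triangular (suc (a + b))
    pair-between a b = m≤n+m _ a , +-monoˡ-< (triangular (a + b)) (s≤s (m≤m+n a b))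

    pair-injective-sum : ∀ {a b a′ b′} → pair a b ≡ pair a′ b′ → a + b ≡ a′ + b′
    pair-injective-sum {a} {b} {a′} {b′} e with <-cmp (a + b) (a′ + b′)
    ... | tri≈ _ s _ = s
    ... | tri< lt _ _ = ⊥-elim (<-irrefl e (<-≤-trans (proj₂ (pair-between a b))
                          (≤-trans (triangular-monotone lt) (proj₁ (pair-between a′ b′)))))
    ... | tri> _ _ gt = ⊥-elim (<-irrefl (sym e) (<-≤-trans (proj₂ (pair-between a′ b′))
                          (≤-trans (triangular-monotone gt) (proj₁ (pair-between a b)))))

  pair-injective : ∀ {a b a′ b′} → pair a b ≡ pair a′ b′ → a ≡ a′ × b ≡ b′
  pair-injective {a} {b} {a′} {b′} e = a≡a′ , +-cancelˡ-≡ a b b′ (trans s (cong (_+ b′) (sym a≡a′)))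
    where
    s : a + b ≡ a′ + b′
    s = pair-injective-sum {a} {b} {a′} {b′} e
    a≡a′ : a ≡ a′
    a≡a′ = +-cancelʳ-≡ (triangular (a + b)) a a′ (trans e (cong (λ k → a′ + triangular k) (sym s)))

open CantorPairing using (pair; pair-injective)

countable-Σ : {I : Set} {B : I → Set} → Countable I → (∀ i → Countable (B i)) → Countable (Σ I B)
countable-Σ {I} {B} (eI , eI-inj) cB = encode , encode-injective
  where
  encode : Σ I B → ℕ
  encode (i , b) = pair (eI i) (proj₁ (cB i) b)
  encode-injective : ∀ {x y} → encode x ≡ encode y → x ≡ y
  encode-injective {i , b} {i′ , b′} e
    with pair-injective {eI i} {proj₁ (cB i) b} {eI i′} {proj₁ (cB i′) b′} e
  ... | ei , eb with eI-inj ei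
  ... | refl = cong (i ,_) (proj₂ (cB i) eb)

fibre-unique : {A I : Set} (π : A → I) {i : I} {a₀ : A} (e₀ : π a₀ ≡ i) →
               (∀ a → π a ≡ i → a ≡ a₀) → (q : Part π i) → q ≡ (a₀ , e₀)
fibre-unique π e₀ unique (a , e) with unique a e
... | refl = cong (a ,_) (uip e e₀)

record DecidableEmbedding (A : Set) : Set where
  field
    encode           : A → ℕ
    encode-injective : Injective _≡_ _≡_ encode
    preimage?        : (j : ℕ) → Dec (Part encode j)

  countable : Countable A
  countable = encode , encode-injective

Antidiagonal : ℕ → Set
Antidiagonal n = Σ[ x ∈ ℕ × ℕ ] proj₁ x + proj₂ x ≡ n

AntidiagonalSplitˡ AntidiagonalSplitʳ : ℕ → Set
AntidiagonalSplitˡ n = Σ (Antidiagonal n) (λ x → Antidiagonal (proj₁ (proj₁ x)))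
AntidiagonalSplitʳ n = Σ (Antidiagonal n) (λ x → Antidiagonal (proj₂ (proj₁ x)))

module _ {n : ℕ} where

  antidiagonal-ext₁ : {x y : Antidiagonal n} → proj₁ (proj₁ x) ≡ proj₁ (proj₁ y) → x ≡ y
  antidiagonal-ext₁ {(a , b) , e} {(.a , b′) , e′} refl with +-cancelˡ-≡ a b b′ (trans e (sym e′))
  ... | refl = cong (_ ,_) (≡-irrelevant e e′)

  antidiagonal-ext₂ : {x y : Antidiagonal n} → proj₂ (proj₁ x) ≡ proj₂ (proj₁ y) → x ≡ y
  antidiagonal-ext₂ {(a , b) , e} {(a′ , .b) , e′} refl with +-cancelʳ-≡ b a a′ (trans e (sym e′))
  ... | refl = cong (_ ,_) (≡-irrelevant e e′)

  antidiagonal-preimage? : (j : ℕ) → Dec (Part {Antidiagonal n} (proj₁ ∘′ proj₁) j)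
  antidiagonal-preimage? j with j ≤? n
  ... | yes j≤n = yes (((j , n ∸ j) , m+[n∸m]≡n j≤n) , refl)
  ... | no j≰n  = no λ { (((a , b) , e) , refl) → j≰n (subst (a ≤_) e (m≤m+n a b)) }

  Antidiagonal-swap : Antidiagonal n ↔ Antidiagonal n
  Antidiagonal-swap = mk↔ₛ′ swap swap (λ _ → antidiagonal-ext₁ refl) (λ _ → antidiagonal-ext₁ refl)
    where
    swap : Antidiagonal n → Antidiagonal n
    swap ((a , b) , e) = (b , a) , trans (+-comm b a) e

  Antidiagonal↔Fin : Antidiagonal n ↔ Fin (suc n)
  Antidiagonal↔Fin = mk↔ₛ′ to from (λ i → fromℕ<-toℕ i _) (λ _ → antidiagonal-ext₁ (toℕ-fromℕ< _))
    where
    to : Antidiagonal n → Fin (suc n)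
    to ((a , b) , e) = fromℕ< (s≤s (subst (a ≤_) e (m≤m+n a b)))
    from : Fin (suc n) → Antidiagonal n
    from i = (toℕ i , n ∸ toℕ i) , m+[n∸m]≡n (toℕ≤pred[n] i)

  Antidiagonal-assoc : AntidiagonalSplitˡ n ↔ AntidiagonalSplitʳ n
  Antidiagonal-assoc = mk↔ₛ′ to from to∘from from∘to
    where
    to : AntidiagonalSplitˡ n → AntidiagonalSplitʳ n
    to (((_ , e) , p) , ((a , b) , q)) =
      ((a , b + e) , trans (sym (+-assoc a b e)) (trans (cong (_+ e) q) p)) , ((b , e) , refl)
    from : AntidiagonalSplitʳ n → AntidiagonalSplitˡ n
    from (((a , _) , p) , ((b , e) , q)) =
      ((a + b , e) , trans (+-assoc a b e) (trans (cong (a +_) q) p)) , ((a , b) , refl)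
    to∘from : ∀ y → to (from y) ≡ y
    to∘from (((a , _) , p) , ((b , e) , refl)) =
      cong (λ p → ((a , b + e) , p) , ((b , e) , refl)) (≡-irrelevant _ _)
    from∘to : ∀ x → from (to x) ≡ x
    from∘to (((_ , e) , p) , ((a , b) , refl)) =
      cong (λ p → ((a + b , e) , p) , ((a , b) , refl)) (≡-irrelevant _ _)

antidiagonal-disjoint : {a b : ℕ} → a ≢ b → (x : Antidiagonal a) (y : Antidiagonal b) → proj₁ x ≢ proj₁ y
antidiagonal-disjoint a≢b ((_ , _) , refl) ((_ , _) , refl) refl = a≢b refl

instance
  ℕ-embedding : DecidableEmbedding ℕ
  ℕ-embedding = record { encode = λ j → j ; encode-injective = λ e → e ; preimage? = λ j → yes (j , refl) }

  antidiagonal-embedding : {n : ℕ} → DecidableEmbedding (Antidiagonal n)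
  antidiagonal-embedding = record
    { encode = proj₁ ∘′ proj₁ ; encode-injective = antidiagonal-ext₁ ; preimage? = antidiagonal-preimage? }

Σ-Antidiagonal↔ℕ×ℕ : Σ ℕ Antidiagonal ↔ (ℕ × ℕ)
Σ-Antidiagonal↔ℕ×ℕ = mk↔ₛ′ (λ (_ , (x , _)) → x) (λ (a , b) → a + b , ((a , b) , refl))
                          (λ _ → refl) (λ { (_ , (_ , refl)) → refl })

module ΣMonoidProperties {ℓ : Level} {X : Set ℓ} (M : IsΣMonoid X) where
  open IsΣMonoid M hiding (sum-functional)
  open IsΣMonoid M public using (sum-functional)

  private variable
    A B I : Set
    s : X

  sum-by-partition : {f : A → X} → Countable A → Countable I → (π : A → I) (g : I → X) →
                     (∀ i → HasSum (λ (q : Part π i) → f (proj₁ q)) (g i)) → HasSum g s → HasSum f s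
  sum-by-partition cA cI π g fibres hg = proj₂ (partition cA cI _ π _) (g , fibres , hg)

  sum-empty : {z : X} → HasSum {⊥} (λ ()) z → ¬ A → (f : A → X) → HasSum f z
  sum-empty h ¬A f = sum-by-partition (⊥-elim ∘′ ¬A , λ {a} → ⊥-elim (¬A a)) ((λ ()) , λ {x} → ⊥-elim x)
                                      (⊥-elim ∘′ ¬A) (λ ()) (λ ()) h

  sum-fibre-singleton : {f : A → X} (π : A → I) {i : I} {a₀ : A} (e₀ : π a₀ ≡ i) →
                        (∀ a → π a ≡ i → a ≡ a₀) → HasSum (λ (q : Part π i) → f (proj₁ q)) (f a₀)
  sum-fibre-singleton π e₀ unique = singleton _ (_ , e₀) (fibre-unique π e₀ unique)

  sum-reindex : {f : A → X} {g : B → X} (e : A ↔ B) → (∀ a → f a ≡ g (Inverse.to e a)) →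
                HasSum g s → HasSum f s
  sum-reindex {A = A} {B = B} {f = f} {g} e f≡g∘to hg = sum-by-partition cA cB to g fibres hg
    where
    open Inverse e using (to; from; strictlyInverseˡ; strictlyInverseʳ)
    cB : Countable B
    cB = index-countable hg
    cA : Countable A
    cA = proj₁ cB ∘′ to , λ {x} {y} ex → trans (sym (strictlyInverseʳ x))
                                          (trans (cong from (proj₂ cB ex)) (strictlyInverseʳ y))
    fibres : ∀ b → HasSum (λ (q : Part to b) → f (proj₁ q)) (g b)
    fibres b = subst (HasSum _) (trans (f≡g∘to (from b)) (cong g (strictlyInverseˡ b)))
                 (sum-fibre-singleton to (strictlyInverseˡ b)
                    (λ a e → trans (sym (strictlyInverseʳ a)) (cong from e)))

  sum-cong : {f g : A → X} → (∀ a → f a ≡ g a) → HasSum g s → HasSum f s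
  sum-cong = sum-reindex (↔-id _)

  sum-of-fibre-sums : {f : A → X} → Countable A → Countable I → (π : A → I) (g : I → X) →
                      (∀ i → HasSum (λ (q : Part π i) → f (proj₁ q)) (g i)) → HasSum f s → HasSum g s
  sum-of-fibre-sums cA cI π g fibres hf with proj₁ (partition cA cI _ π _) hf
  ... | g′ , fibres′ , hg′ = sum-cong (λ i → sum-functional (fibres i) (fibres′ i)) hg′

  sum-Σ : {B : I → Set} {f : Σ I B → X} (t : I → X) →
          (∀ i → HasSum (λ b → f (i , b)) (t i)) → HasSum t s → HasSum f s
  sum-Σ {I = I} {B = B} {f = f} t inner ht =
    sum-by-partition (countable-Σ cI (λ i → index-countable (inner i))) cI proj₁ t fibres ht
    where
    cI : Countable I
    cI = index-countable ht
    fibre↔ : (i : I) → Part {Σ I B} proj₁ i ↔ B i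
    fibre↔ i = mk↔ₛ′ (λ { ((_ , b) , refl) → b }) (λ b → (i , b) , refl)
                     (λ _ → refl) (λ { ((_ , _) , refl) → refl })
    fibres : ∀ i → HasSum (λ (q : Part proj₁ i) → f (proj₁ q)) (t i)
    fibres i = sum-reindex (fibre↔ i) (λ { ((_ , _) , refl) → refl }) (inner i)

module MonoidalReasoning {o ℓ : Level} (C : SymmetricMonoidalCategory o ℓ) where
  open SymmetricMonoidalCategory C public
  open ≡-Reasoning

  private variable
    X Y Z : Obj
    a b c d f g h k : Hom X Y

  infixr 4 _⟩∘⟨_ refl⟩∘⟨_ _⟩⊗⟨_
  infixl 5 _⟩∘⟨refl

  _⟩∘⟨_ : f ≡ h → g ≡ k → f ∘ g ≡ h ∘ k
  _⟩∘⟨_ = cong₂ _∘_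

  refl⟩∘⟨_ : g ≡ k → f ∘ g ≡ f ∘ k
  refl⟩∘⟨_ = cong _

  _⟩∘⟨refl : f ≡ h → f ∘ g ≡ h ∘ g
  e ⟩∘⟨refl = cong (_∘ _) e

  _⟩⊗⟨_ : f ≡ h → g ≡ k → f ⊗₁ g ≡ h ⊗₁ k
  _⟩⊗⟨_ = cong₂ _⊗₁_

  id-comm : id ∘ f ≡ f ∘ id
  id-comm = trans identityˡ (sym identityʳ)

  pullˡ : a ∘ b ≡ c → a ∘ b ∘ f ≡ c ∘ f
  pullˡ e = trans (sym assoc) (e ⟩∘⟨refl)

  pullʳ : b ∘ c ≡ d → (a ∘ b) ∘ c ≡ a ∘ d
  pullʳ e = trans assoc (refl⟩∘⟨ e)

  extendʳ : a ∘ b ≡ c ∘ d → a ∘ b ∘ f ≡ c ∘ d ∘ f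
  extendʳ e = trans (pullˡ e) assoc

  elimˡ : a ≡ id → a ∘ f ≡ f
  elimˡ e = trans (e ⟩∘⟨refl) identityˡ

  elimʳ : a ≡ id → f ∘ a ≡ f
  elimʳ e = trans (refl⟩∘⟨ e) identityʳ

  cancelˡ : a ∘ b ≡ id → a ∘ b ∘ f ≡ f
  cancelˡ e = trans (pullˡ e) identityˡ

  cancelʳ : a ∘ b ≡ id → (f ∘ a) ∘ b ≡ f
  cancelʳ e = trans (pullʳ e) identityʳ

  epi-cancel : a ∘ b ≡ id → f ∘ a ≡ g ∘ a → f ≡ g
  epi-cancel ab e = trans (sym (elimʳ ab)) (trans (pullˡ e) (cancelʳ ab))

  mono-cancel : b ∘ a ≡ id → a ∘ f ≡ a ∘ g → f ≡ g
  mono-cancel ba e = trans (sym (cancelˡ ba)) (trans (refl⟩∘⟨ e) (cancelˡ ba))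

  inverse-unique : c ∘ a ≡ id → a ∘ b ≡ id → b ≡ c
  inverse-unique ca ab = trans (sym (cancelˡ ca)) (elimʳ ab)

  inverse-natural : a ∘ b ≡ id → c ∘ d ≡ id → d ∘ f ≡ g ∘ a → f ∘ b ≡ c ∘ g
  inverse-natural {a = a} {b = b} {c = c} {d = d} {f = f} {g = g} ab cd e = begin
    f ∘ b           ≡⟨ sym (cancelˡ cd) ⟩
    c ∘ d ∘ f ∘ b   ≡⟨ refl⟩∘⟨ extendʳ e ⟩
    c ∘ g ∘ a ∘ b   ≡⟨ refl⟩∘⟨ elimʳ ab ⟩
    c ∘ g           ∎

  λ⇐-natural : λ⇐ ∘ f ≡ (id ⊗₁ f) ∘ λ⇐
  λ⇐-natural = sym (inverse-natural λ-iso₁ λ-iso₂ λ-natural)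

  ρ⇐-natural : ρ⇐ ∘ f ≡ (f ⊗₁ id) ∘ ρ⇐
  ρ⇐-natural = sym (inverse-natural ρ-iso₁ ρ-iso₂ ρ-natural)

  α⇐-natural : α⇐ ∘ (f ⊗₁ (g ⊗₁ h)) ≡ ((f ⊗₁ g) ⊗₁ h) ∘ α⇐
  α⇐-natural = sym (inverse-natural α-iso₁ α-iso₂ α-natural)

  serialize₁₂ : f ⊗₁ g ≡ (f ⊗₁ id) ∘ (id ⊗₁ g)
  serialize₁₂ = trans (sym identityʳ ⟩⊗⟨ sym identityˡ) ⊗-∘

  serialize₂₁ : f ⊗₁ g ≡ (id ⊗₁ g) ∘ (f ⊗₁ id)
  serialize₂₁ = trans (sym identityˡ ⟩⊗⟨ sym identityʳ) ⊗-∘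

  ⊗-inverse : a ∘ b ≡ id → c ∘ d ≡ id → (a ⊗₁ c) ∘ (b ⊗₁ d) ≡ id
  ⊗-inverse ab cd = trans (sym ⊗-∘) (trans (ab ⟩⊗⟨ cd) ⊗-id)

  unitˡ-conjugate : id {unit} ⊗₁ f ≡ λ⇐ ∘ f ∘ λ⇒
  unitˡ-conjugate = trans (sym (cancelˡ λ-iso₂)) (refl⟩∘⟨ λ-natural)

  unitʳ-conjugate : f ⊗₁ id {unit} ≡ ρ⇐ ∘ f ∘ ρ⇒
  unitʳ-conjugate = trans (sym (cancelˡ ρ-iso₂)) (refl⟩∘⟨ ρ-natural)

  id⊗-injective : id {unit} ⊗₁ f ≡ id ⊗₁ g → f ≡ g
  id⊗-injective e = epi-cancel λ-iso₁ (mono-cancel λ-iso₁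
    (trans (sym unitˡ-conjugate) (trans e unitˡ-conjugate)))

  ⊗id-injective : f ⊗₁ id {unit} ≡ g ⊗₁ id → f ≡ g
  ⊗id-injective e = epi-cancel ρ-iso₁ (mono-cancel ρ-iso₁
    (trans (sym unitʳ-conjugate) (trans e unitʳ-conjugate)))

  kelly : λ⇒ {X ⊗₀ Y} ∘ α⇒ ≡ λ⇒ ⊗₁ id
  kelly = id⊗-injective (epi-cancel α-iso₁ (epi-cancel (⊗-inverse α-iso₁ identityˡ)
    (trans assoc (trans pentagon-image (sym assoc)))))
    where
    pentagon-image : (id ⊗₁ (λ⇒ ∘ α⇒)) ∘ α⇒ ∘ (α⇒ ⊗₁ id) ≡ (id ⊗₁ (λ⇒ ⊗₁ id)) ∘ α⇒ ∘ (α⇒ ⊗₁ id)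
    pentagon-image = begin
      (id ⊗₁ (λ⇒ ∘ α⇒)) ∘ α⇒ ∘ (α⇒ ⊗₁ id)            ≡⟨ trans (sym identityˡ ⟩⊗⟨ refl) ⊗-∘ ⟩∘⟨refl ⟩
      ((id ⊗₁ λ⇒) ∘ (id ⊗₁ α⇒)) ∘ α⇒ ∘ (α⇒ ⊗₁ id)    ≡⟨ pullʳ pentagon ⟩
      (id ⊗₁ λ⇒) ∘ α⇒ ∘ α⇒                          ≡⟨ pullˡ triangle ⟩
      (ρ⇒ ⊗₁ id) ∘ α⇒                               ≡⟨ (refl ⟩⊗⟨ sym ⊗-id) ⟩∘⟨refl ⟩
      (ρ⇒ ⊗₁ (id ⊗₁ id)) ∘ α⇒                       ≡⟨ sym α-natural ⟩
      α⇒ ∘ ((ρ⇒ ⊗₁ id) ⊗₁ id)                       ≡⟨ refl⟩∘⟨ (sym triangle ⟩⊗⟨ sym identityˡ) ⟩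
      α⇒ ∘ (((id ⊗₁ λ⇒) ∘ α⇒) ⊗₁ (id ∘ id))         ≡⟨ refl⟩∘⟨ ⊗-∘ ⟩
      α⇒ ∘ ((id ⊗₁ λ⇒) ⊗₁ id) ∘ (α⇒ ⊗₁ id)          ≡⟨ extendʳ α-natural ⟩
      (id ⊗₁ (λ⇒ ⊗₁ id)) ∘ α⇒ ∘ (α⇒ ⊗₁ id)          ∎

  λ⇒-unit⊗ : λ⇒ {unit ⊗₀ X} ≡ id ⊗₁ λ⇒
  λ⇒-unit⊗ = mono-cancel λ-iso₂ (sym λ-natural)

  λ≡ρ : λ⇒ {unit} ≡ ρ⇒
  λ≡ρ = ⊗id-injective (trans (sym kelly) (trans (λ⇒-unit⊗ ⟩∘⟨refl) triangle))

  λ⇐≡ρ⇐ : λ⇐ {unit} ≡ ρ⇐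
  λ⇐≡ρ⇐ = sym (inverse-unique (trans (refl⟩∘⟨ sym λ≡ρ) λ-iso₂) ρ-iso₁)

  α⇒∘λ⇐⊗id : α⇒ ∘ (λ⇐ {X} ⊗₁ id {Y}) ≡ λ⇐
  α⇒∘λ⇐⊗id = begin
    α⇒ ∘ (λ⇐ ⊗₁ id)                ≡⟨ sym (cancelˡ λ-iso₂) ⟩
    λ⇐ ∘ λ⇒ ∘ α⇒ ∘ (λ⇐ ⊗₁ id)       ≡⟨ refl⟩∘⟨ pullˡ kelly ⟩
    λ⇐ ∘ (λ⇒ ⊗₁ id) ∘ (λ⇐ ⊗₁ id)    ≡⟨ elimʳ (⊗-inverse λ-iso₁ identityˡ) ⟩
    λ⇐                             ∎

  unit-⊗-swap : {f : Hom unit unit} → id {unit} ⊗₁ f ≡ f ⊗₁ id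
  unit-⊗-swap = trans unitˡ-conjugate (trans (λ⇐≡ρ⇐ ⟩∘⟨ refl⟩∘⟨ λ≡ρ) (sym unitʳ-conjugate))

  -- With u := λ ∘ γ ∘ λ⁻¹ we have γ₁₁ = id ⊗ u = u ⊗ id; the hexagon at (1, 1, 1) then forces u ⊗ id = id.
  γ-unit : γ {unit} {unit} ≡ id
  γ-unit = trans γ≡id⊗u (trans (refl ⟩⊗⟨ u≡id) ⊗-id)
    where
    u : Hom unit unit
    u = λ⇒ ∘ γ ∘ λ⇐

    γ≡id⊗u : γ ≡ id ⊗₁ u
    γ≡id⊗u = sym (begin
      id ⊗₁ u                  ≡⟨ unitˡ-conjugate ⟩
      λ⇐ ∘ (λ⇒ ∘ γ ∘ λ⇐) ∘ λ⇒   ≡⟨ refl⟩∘⟨ pullʳ (pullʳ λ-iso₂) ⟩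
      λ⇐ ∘ λ⇒ ∘ γ ∘ id          ≡⟨ cancelˡ λ-iso₂ ⟩
      γ ∘ id                   ≡⟨ identityʳ ⟩
      γ                        ∎)

    γ-unit-assoc : γ {unit} {unit ⊗₀ unit} ≡ (λ⇐ ⊗₁ id) ∘ γ ∘ (id ⊗₁ λ⇒)
    γ-unit-assoc = trans (sym (elimʳ (⊗-inverse identityˡ λ-iso₂))) (extendʳ γ-natural)

    hexagon-left : α⇒ ∘ γ ∘ α⇒ ≡ (id ⊗₁ γ) ∘ α⇒ {unit} {unit} {unit}
    hexagon-left = begin
      α⇒ ∘ γ ∘ α⇒                                  ≡⟨ refl⟩∘⟨ γ-unit-assoc ⟩∘⟨refl ⟩
      α⇒ ∘ ((λ⇐ ⊗₁ id) ∘ γ ∘ (id ⊗₁ λ⇒)) ∘ α⇒       ≡⟨ refl⟩∘⟨ trans assoc (refl⟩∘⟨ assoc) ⟩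
      α⇒ ∘ (λ⇐ ⊗₁ id) ∘ γ ∘ (id ⊗₁ λ⇒) ∘ α⇒         ≡⟨ pullˡ α⇒∘λ⇐⊗id ⟩
      λ⇐ ∘ γ ∘ (id ⊗₁ λ⇒) ∘ α⇒                     ≡⟨ extendʳ λ⇐-natural ⟩
      (id ⊗₁ γ) ∘ λ⇐ ∘ (id ⊗₁ λ⇒) ∘ α⇒             ≡⟨ refl⟩∘⟨ cancelˡ (trans (refl⟩∘⟨ sym λ⇒-unit⊗) λ-iso₂) ⟩
      (id ⊗₁ γ) ∘ α⇒                               ∎

    hexagon-right : (id ⊗₁ γ) ∘ α⇒ ∘ (γ ⊗₁ id) ≡ (id ⊗₁ γ) ∘ (u ⊗₁ id) ∘ α⇒ {unit} {unit} {unit}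
    hexagon-right = begin
      (id ⊗₁ γ) ∘ α⇒ ∘ (γ ⊗₁ id)          ≡⟨ refl⟩∘⟨ refl⟩∘⟨ (trans γ≡id⊗u unit-⊗-swap ⟩⊗⟨ refl) ⟩
      (id ⊗₁ γ) ∘ α⇒ ∘ ((u ⊗₁ id) ⊗₁ id)  ≡⟨ refl⟩∘⟨ α-natural ⟩
      (id ⊗₁ γ) ∘ (u ⊗₁ (id ⊗₁ id)) ∘ α⇒  ≡⟨ refl⟩∘⟨ (refl ⟩⊗⟨ ⊗-id) ⟩∘⟨refl ⟩
      (id ⊗₁ γ) ∘ (u ⊗₁ id) ∘ α⇒          ∎

    u⊗id≡id : u ⊗₁ id {unit ⊗₀ unit} ≡ id
    u⊗id≡id = sym (epi-cancel α-iso₁ (trans identityˡ (mono-cancel (⊗-inverse identityˡ γ-involutive)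
      (trans (sym hexagon-left) (trans hexagon hexagon-right)))))

    u≡id : u ≡ id
    u≡id = ⊗id-injective (begin
      u ⊗₁ id                                ≡⟨ sym (cancelˡ (⊗-inverse identityˡ λ-iso₁)) ⟩
      (id ⊗₁ λ⇒) ∘ (id ⊗₁ λ⇐) ∘ (u ⊗₁ id)     ≡⟨ refl⟩∘⟨ trans (sym serialize₂₁) serialize₁₂ ⟩
      (id ⊗₁ λ⇒) ∘ (u ⊗₁ id) ∘ (id ⊗₁ λ⇐)     ≡⟨ refl⟩∘⟨ elimˡ u⊗id≡id ⟩
      (id ⊗₁ λ⇒) ∘ (id ⊗₁ λ⇐)                ≡⟨ ⊗-inverse identityˡ λ-iso₁ ⟩
      id                                     ≡⟨ sym ⊗-id ⟩
      id ⊗₁ id                               ∎)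

  middle-swap-natural : (α⇒ ∘ (γ ⊗₁ id) ∘ α⇐) ∘ (f ⊗₁ (g ⊗₁ h)) ≡ (g ⊗₁ (f ⊗₁ h)) ∘ α⇒ ∘ (γ ⊗₁ id) ∘ α⇐
  middle-swap-natural {f = f} {g = g} {h = h} = begin
    (α⇒ ∘ (γ ⊗₁ id) ∘ α⇐) ∘ (f ⊗₁ (g ⊗₁ h))   ≡⟨ pullʳ (pullʳ α⇐-natural) ⟩
    α⇒ ∘ (γ ⊗₁ id) ∘ ((f ⊗₁ g) ⊗₁ h) ∘ α⇐
      ≡⟨ refl⟩∘⟨ extendʳ (trans (sym ⊗-∘) (trans (γ-natural ⟩⊗⟨ id-comm) ⊗-∘)) ⟩
    α⇒ ∘ ((g ⊗₁ f) ⊗₁ h) ∘ (γ ⊗₁ id) ∘ α⇐     ≡⟨ extendʳ α-natural ⟩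
    (g ⊗₁ (f ⊗₁ h)) ∘ α⇒ ∘ (γ ⊗₁ id) ∘ α⇐     ∎

  s₂₃-natural : s₂₃ ∘ ((f ⊗₁ g) ⊗₁ (h ⊗₁ k)) ≡ ((f ⊗₁ h) ⊗₁ (g ⊗₁ k)) ∘ s₂₃
  s₂₃-natural = trans (pullʳ (pullʳ α-natural)) (trans
    (refl⟩∘⟨ extendʳ (trans (sym ⊗-∘) (trans (id-comm ⟩⊗⟨ middle-swap-natural) ⊗-∘)))
    (extendʳ α⇐-natural))

  s₂₃-unit : s₂₃ {unit} {unit} {unit} {unit} ≡ id
  s₂₃-unit = trans (refl⟩∘⟨ elimˡ (trans (refl ⟩⊗⟨ middle-swap-unit) ⊗-id)) α-iso₂
    where
    middle-swap-unit : α⇒ ∘ (γ ⊗₁ id) ∘ α⇐ ≡ id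
    middle-swap-unit = trans (refl⟩∘⟨ elimˡ (trans (γ-unit ⟩⊗⟨ refl) ⊗-id)) α-iso₁

module RepresentableSums {o ℓ : Level} (C : SymmetricMonoidalCategory o ℓ)
                         (R : RepresentablyΣAdditive C) where
  open MonoidalReasoning C public
  open RepresentablyΣAdditive R public
  open ≡-Reasoning

  module _ {X Y : Obj} where
    open ΣMonoidProperties (ΣHom X Y) public

  private variable
    A : Set
    W X Y Z : Obj
    s : Hom X Y

  δ-diag : (i : ℕ) → δ i i ≡ id
  δ-diag i with i ≟ i
  ... | yes _   = refl
  ... | no i≢i  = ⊥-elim (i≢i refl)

  δ-offdiag : {j i : ℕ} → j ≢ i → δ j i ≡ 𝟎
  δ-offdiag {j} {i} j≢i with j ≟ i
  ... | yes j≡i = ⊥-elim (j≢i j≡i)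
  ... | no _    = refl

  p∘inj : (j i : ℕ) → p j ∘ inj i ≡ δ j i
  p∘inj j i = ⟨⟩-proj _ j

  p∘inj-diag : (i : ℕ) → p i ∘ inj i ≡ id
  p∘inj-diag i = trans (p∘inj i i) (δ-diag i)

  p∘inj-offdiag : {j i : ℕ} → j ≢ i → p j ∘ inj i ≡ 𝟎
  p∘inj-offdiag j≢i = trans (p∘inj _ _) (δ-offdiag j≢i)

  p∘Δ : (j : ℕ) → p j ∘ Δ ≡ id
  p∘Δ j = ⟨⟩-proj _ j

  𝟎⊗-∘ : {g : Hom Y Z} {h : Hom W (X ⊗₀ Y)} {X′ : Obj} → (𝟎 {X} {X′} ⊗₁ g) ∘ h ≡ 𝟎
  𝟎⊗-∘ = trans (𝟎-⊗ˡ ⟩∘⟨refl) 𝟎-∘ʳ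

  ⊗𝟎-∘ : {f : Hom X Y} {h : Hom W (X ⊗₀ Z)} {Z′ : Obj} → (f ⊗₁ 𝟎 {Z} {Z′}) ∘ h ≡ 𝟎
  ⊗𝟎-∘ = trans (𝟎-⊗ʳ ⟩∘⟨refl) 𝟎-∘ʳ

  p-jointly-monic : {f g : Hom X D} → (∀ i → p i ∘ f ≡ p i ∘ g) → f ≡ g
  p-jointly-monic {g = g} e = trans (⟨⟩-unique _ _ e) (sym (⟨⟩-unique _ g (λ _ → refl)))

  -- plug h (inj i) is the i-th term and plug h Δ the sum of the family witnessed by h (RS-sum)
  plug : Hom (X ⊗₀ D) Y → Hom unit D → Hom X Y
  plug h d = h ∘ (id ⊗₁ d) ∘ ρ⇐

  witness-ext : {h h′ : Hom (X ⊗₀ D) Y} → (∀ i → plug h (inj i) ≡ plug h′ (inj i)) → h ≡ h′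
  witness-ext {h = h} {h′} e = RS-epi h h′ (λ i → epi-cancel ρ-iso₂ (trans assoc (trans (e i) (sym assoc))))

  plug-natural : (u : Hom Y Z) (h : Hom (X ⊗₀ D) Y) (v : Hom W X) (d : Hom unit D) →
                 plug (u ∘ h ∘ (v ⊗₁ id)) d ≡ u ∘ plug h d ∘ v
  plug-natural u h v d = begin
    (u ∘ h ∘ (v ⊗₁ id)) ∘ (id ⊗₁ d) ∘ ρ⇐  ≡⟨ trans assoc (refl⟩∘⟨ assoc) ⟩
    u ∘ h ∘ (v ⊗₁ id) ∘ (id ⊗₁ d) ∘ ρ⇐    ≡⟨ refl⟩∘⟨ refl⟩∘⟨ extendʳ (trans (sym serialize₁₂) serialize₂₁) ⟩
    u ∘ h ∘ (id ⊗₁ d) ∘ (v ⊗₁ id) ∘ ρ⇐    ≡⟨ refl⟩∘⟨ refl⟩∘⟨ refl⟩∘⟨ sym ρ⇐-natural ⟩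
    u ∘ h ∘ (id ⊗₁ d) ∘ ρ⇐ ∘ v            ≡⟨ refl⟩∘⟨ sym (trans assoc (refl⟩∘⟨ assoc)) ⟩
    u ∘ (h ∘ (id ⊗₁ d) ∘ ρ⇐) ∘ v          ∎

  plug-unitor : (f : Hom D Y) (d : Hom unit D) → plug (f ∘ λ⇒) d ≡ f ∘ d
  plug-unitor f d = begin
    (f ∘ λ⇒) ∘ (id ⊗₁ d) ∘ ρ⇐  ≡⟨ pullʳ (pullˡ λ-natural) ⟩
    f ∘ (d ∘ λ⇒) ∘ ρ⇐          ≡⟨ refl⟩∘⟨ pullʳ (trans (λ≡ρ ⟩∘⟨refl) ρ-iso₁) ⟩
    f ∘ d ∘ id                 ≡⟨ refl⟩∘⟨ identityʳ ⟩
    f ∘ d                      ∎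

  sum-inj : (f : Hom D Y) → HasSum (λ n → f ∘ inj n) (f ∘ Δ)
  sum-inj f = subst (HasSum _) (plug-unitor f Δ) (RS-sum⇐ _ (f ∘ λ⇒) (λ n → plug-unitor f (inj n)))

  inj-jointly-epic : {f g : Hom D Y} → (∀ n → f ∘ inj n ≡ g ∘ inj n) → f ≡ g
  inj-jointly-epic e = epi-cancel λ-iso₁
    (witness-ext (λ n → trans (plug-unitor _ _) (trans (e n) (sym (plug-unitor _ _)))))

  inj⊗inj-jointly-epic : {f g : Hom (D ⊗₀ D) Y} →
                         (∀ a b → f ∘ (inj a ⊗₁ inj b) ≡ g ∘ (inj a ⊗₁ inj b)) → f ≡ g
  inj⊗inj-jointly-epic {f = f} {g} e = RS-epi f g (λ b → epi-cancel ρ-iso₂ (trans assoc (trans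
    (inj-jointly-epic (λ a → trans (restrict f a b) (trans (extendʳ (e a b)) (sym (restrict g a b)))))
    (sym assoc))))
    where
    restrict : (h : Hom (D ⊗₀ D) Y) (a b : ℕ) →
               (h ∘ (id ⊗₁ inj b) ∘ ρ⇐) ∘ inj a ≡ h ∘ (inj a ⊗₁ inj b) ∘ ρ⇐
    restrict h a b = pullʳ (trans (pullʳ ρ⇐-natural) (pullˡ (sym serialize₂₁)))

  sum-witness : {f : ℕ → Hom X Y} → HasSum f s →
                Σ[ h ∈ Hom (X ⊗₀ D) Y ] ((∀ j → plug h (inj j) ≡ f j) × plug h Δ ≡ s)
  sum-witness {f = f} hf = let (h , hh) = RS-sum⇒ f (_ , hf) in h , hh , sum-functional (RS-sum⇐ f h hh) hf

  private
    sum-ℕ-∘ : {f : ℕ → Hom X Y} (u : Hom Y Z) (v : Hom W X) → HasSum f s →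
              HasSum (λ j → u ∘ f j ∘ v) (u ∘ s ∘ v)
    sum-ℕ-∘ u v hf with sum-witness hf
    ... | h , hh , refl = subst (HasSum _) (plug-natural u h v Δ)
      (RS-sum⇐ _ (u ∘ h ∘ (v ⊗₁ id)) (λ j → trans (plug-natural u h v (inj j)) (refl⟩∘⟨ hh j ⟩∘⟨refl)))

    sum-ℕ-single : {f : ℕ → Hom X Y} (k : ℕ) → (∀ j → j ≢ k → f j ≡ 𝟎) → HasSum f s → s ≡ f k
    sum-ℕ-single {X = X} {Y = Y} {f = f} k others hf with sum-witness hf
    ... | h , hh , refl = trans (cong (λ h → plug h Δ) (witness-ext components))
                                (trans (plug-concentrated Δ) (trans (cong scaled (p∘Δ k)) scaled-id))
      where
      concentrated : Hom (X ⊗₀ D) Y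
      concentrated = f k ∘ ρ⇒ ∘ (id ⊗₁ p k)

      scaled : Hom unit unit → Hom X Y
      scaled σ = f k ∘ ρ⇒ ∘ (id ⊗₁ σ) ∘ ρ⇐

      plug-concentrated : (d : Hom unit D) → plug concentrated d ≡ scaled (p k ∘ d)
      plug-concentrated d = trans (trans assoc (refl⟩∘⟨ assoc))
        (refl⟩∘⟨ refl⟩∘⟨ pullˡ (trans (sym ⊗-∘) (identityˡ ⟩⊗⟨ refl)))

      scaled-id : scaled id ≡ f k
      scaled-id = elimʳ (trans (refl⟩∘⟨ elimˡ ⊗-id) ρ-iso₁)

      scaled-𝟎 : scaled 𝟎 ≡ 𝟎
      scaled-𝟎 = trans (refl⟩∘⟨ refl⟩∘⟨ trans (𝟎-⊗ʳ ⟩∘⟨refl) 𝟎-∘ʳ) (trans (refl⟩∘⟨ 𝟎-∘ˡ) 𝟎-∘ˡ)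

      components : ∀ j → plug h (inj j) ≡ plug concentrated (inj j)
      components j with j ≟ k
      ... | yes refl = trans (hh j) (sym (trans (plug-concentrated (inj j))
                         (trans (cong scaled (p∘inj-diag j)) scaled-id)))
      ... | no j≢k   = trans (hh j) (trans (others j j≢k) (sym (trans (plug-concentrated (inj j))
                         (trans (cong scaled (p∘inj-offdiag (λ k≡j → j≢k (sym k≡j)))) scaled-𝟎))))

  -- Padding by 𝟎 along the embedding turns a family into an ℕ-indexed one with the same sums,
  -- and ℕ-indexed sums have witnesses, on which composition acts directly.
  module _ {A : Set} {{E : DecidableEmbedding A}} where
    open DecidableEmbedding E

    pad : (A → Hom X Y) → ℕ → Hom X Y
    pad f j with preimage? j
    ... | yes (a , _) = f a
    ... | no _        = 𝟎

    private
      pad-fibre : (f : A → Hom X Y) (j : ℕ) → HasSum (λ (q : Part encode j) → f (proj₁ q)) (pad f j)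
      pad-fibre f j with preimage? j
      ... | yes (a , e) = sum-fibre-singleton encode e (λ a′ e′ → encode-injective (trans e′ (sym e)))
      ... | no ∄        = sum-empty 𝟎-empty ∄ _

      sum⇒pad-sum : {f : A → Hom X Y} → HasSum f s → HasSum (pad f) s
      sum⇒pad-sum {f = f} = sum-of-fibre-sums countable (DecidableEmbedding.countable ℕ-embedding)
                              encode (pad f) (pad-fibre f)

      pad-sum⇒sum : {f : A → Hom X Y} → HasSum (pad f) s → HasSum f s
      pad-sum⇒sum {f = f} = sum-by-partition countable (DecidableEmbedding.countable ℕ-embedding)
                              encode (pad f) (pad-fibre f)

      pad-∘ : (u : Hom Y Z) (v : Hom W X) (f : A → Hom X Y) (j : ℕ) →
              pad (λ a → u ∘ f a ∘ v) j ≡ u ∘ pad f j ∘ v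
      pad-∘ u v f j with preimage? j
      ... | yes _ = refl
      ... | no _  = sym (trans (refl⟩∘⟨ 𝟎-∘ʳ) 𝟎-∘ˡ)

      pad-encode : (f : A → Hom X Y) (a : A) → pad f (encode a) ≡ f a
      pad-encode f a with preimage? (encode a)
      ... | yes (a′ , e) = cong f (encode-injective e)
      ... | no ∄         = ⊥-elim (∄ (a , refl))

    sum-∘ : {f : A → Hom X Y} (u : Hom Y Z) (v : Hom W X) → HasSum f s →
            HasSum (λ a → u ∘ f a ∘ v) (u ∘ s ∘ v)
    sum-∘ u v hf = pad-sum⇒sum (sum-cong (pad-∘ u v _) (sum-ℕ-∘ u v (sum⇒pad-sum hf)))

    sum-∘ˡ : {f : A → Hom X Y} (u : Hom Y Z) → HasSum f s → HasSum (λ a → u ∘ f a) (u ∘ s)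
    sum-∘ˡ u hf = subst (HasSum _) (refl⟩∘⟨ identityʳ)
                    (sum-cong (λ _ → refl⟩∘⟨ sym identityʳ) (sum-∘ u id hf))

    sum-∘ʳ : {f : A → Hom X Y} (v : Hom W X) → HasSum f s → HasSum (λ a → f a ∘ v) (s ∘ v)
    sum-∘ʳ v hf = subst (HasSum _) identityˡ (sum-cong (λ _ → sym identityˡ) (sum-∘ id v hf))

    sum-⊗ˡ : {f : A → Hom unit Y} (z : Hom unit W) → HasSum f s → HasSum (λ a → f a ⊗₁ z) (s ⊗₁ z)
    sum-⊗ˡ z hf = subst (HasSum _) (sym as-composite)
                    (sum-cong (λ _ → as-composite) (sum-∘ ((id ⊗₁ z) ∘ ρ⇐) ρ⇒ hf))
      where
      as-composite : {x : Hom unit _} → x ⊗₁ z ≡ ((id ⊗₁ z) ∘ ρ⇐) ∘ x ∘ ρ⇒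
      as-composite = trans serialize₂₁ (trans (refl⟩∘⟨ unitʳ-conjugate) (sym assoc))

    sum-⊗ʳ : {f : A → Hom unit Y} (z : Hom unit W) → HasSum f s → HasSum (λ a → z ⊗₁ f a) (z ⊗₁ s)
    sum-⊗ʳ z hf = subst (HasSum _) (sym as-composite)
                    (sum-cong (λ _ → as-composite) (sum-∘ ((z ⊗₁ id) ∘ λ⇐) λ⇒ hf))
      where
      as-composite : {x : Hom unit _} → z ⊗₁ x ≡ ((z ⊗₁ id) ∘ λ⇐) ∘ x ∘ λ⇒
      as-composite = trans serialize₁₂ (trans (refl⟩∘⟨ unitˡ-conjugate) (sym assoc))

    sum-single : {f : A → Hom X Y} (a₀ : A) → (∀ a → a ≢ a₀ → f a ≡ 𝟎) → HasSum f s → s ≡ f a₀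
    sum-single {f = f} a₀ others hf =
      trans (sum-ℕ-single (encode a₀) padded-others (sum⇒pad-sum hf)) (pad-encode f a₀)
      where
      padded-others : ∀ j → j ≢ encode a₀ → pad f j ≡ 𝟎
      padded-others j j≢ with preimage? j
      ... | yes (a , e) = others a (λ a≡a₀ → j≢ (trans (sym e) (cong encode a≡a₀)))
      ... | no _        = refl

    -- postcomposing with 𝟎 leaves a sum of zeros unchanged, and turns its total into 𝟎
    sum-zero : {f : A → Hom X Y} → (∀ a → f a ≡ 𝟎) → HasSum f s → s ≡ 𝟎
    sum-zero zeros hf =
      trans (sum-functional hf (sum-cong (λ a → trans (zeros a) (sym 𝟎-∘ʳ)) (sum-∘ 𝟎 id hf))) 𝟎-∘ʳ

module ProductMonoid {o ℓ : Level} (C : SymmetricMonoidalCategory o ℓ) (R : RepresentablyΣAdditive C) where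
  open RepresentableSums C R
  open ≡-Reasoning

  private variable
    X Y : Obj

  p∘m∘⊗ : (i : ℕ) (f : Hom X D) (g : Hom Y D) → p i ∘ m ∘ (f ⊗₁ g) ≡ λ⇒ ∘ ((p i ∘ f) ⊗₁ (p i ∘ g))
  p∘m∘⊗ i f g = trans (pullˡ (⟨⟩-proj _ i)) (pullʳ (sym ⊗-∘))

  m-unitˡ : m ∘ (Δ ⊗₁ id) ≡ λ⇒
  m-unitˡ = p-jointly-monic λ i → begin
    p i ∘ m ∘ (Δ ⊗₁ id)             ≡⟨ p∘m∘⊗ i Δ id ⟩
    λ⇒ ∘ ((p i ∘ Δ) ⊗₁ (p i ∘ id))  ≡⟨ refl⟩∘⟨ (p∘Δ i ⟩⊗⟨ identityʳ) ⟩
    λ⇒ ∘ (id ⊗₁ p i)                ≡⟨ λ-natural ⟩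
    p i ∘ λ⇒                        ∎

  m-unitʳ : m ∘ (id ⊗₁ Δ) ≡ ρ⇒
  m-unitʳ = p-jointly-monic λ i → begin
    p i ∘ m ∘ (id ⊗₁ Δ)             ≡⟨ p∘m∘⊗ i id Δ ⟩
    λ⇒ ∘ ((p i ∘ id) ⊗₁ (p i ∘ Δ))  ≡⟨ λ≡ρ ⟩∘⟨ (identityʳ ⟩⊗⟨ p∘Δ i) ⟩
    ρ⇒ ∘ (p i ⊗₁ id)                ≡⟨ ρ-natural ⟩
    p i ∘ ρ⇒                        ∎

  m-assoc : m ∘ (m ⊗₁ id) ≡ m ∘ (id ⊗₁ m) ∘ α⇒
  m-assoc = p-jointly-monic λ i → let q = p i in begin
    q ∘ m ∘ (m ⊗₁ id)                              ≡⟨ p∘m∘⊗ i m id ⟩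
    λ⇒ ∘ ((q ∘ m) ⊗₁ (q ∘ id))                     ≡⟨ refl⟩∘⟨ (⟨⟩-proj _ i ⟩⊗⟨ sym id-comm) ⟩
    λ⇒ ∘ ((λ⇒ ∘ (q ⊗₁ q)) ⊗₁ (id ∘ q))             ≡⟨ refl⟩∘⟨ ⊗-∘ ⟩
    λ⇒ ∘ (λ⇒ ⊗₁ id) ∘ ((q ⊗₁ q) ⊗₁ q)              ≡⟨ refl⟩∘⟨ (trans (λ≡ρ ⟩⊗⟨ refl) (sym triangle)) ⟩∘⟨refl ⟩
    λ⇒ ∘ ((id ⊗₁ λ⇒) ∘ α⇒) ∘ ((q ⊗₁ q) ⊗₁ q)       ≡⟨ refl⟩∘⟨ pullʳ α-natural ⟩
    λ⇒ ∘ (id ⊗₁ λ⇒) ∘ (q ⊗₁ (q ⊗₁ q)) ∘ α⇒         ≡⟨ refl⟩∘⟨ pullˡ (sym ⊗-∘) ⟩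
    λ⇒ ∘ ((id ∘ q) ⊗₁ (λ⇒ ∘ (q ⊗₁ q))) ∘ α⇒        ≡⟨ refl⟩∘⟨ (id-comm ⟩⊗⟨ sym (⟨⟩-proj _ i)) ⟩∘⟨refl ⟩
    λ⇒ ∘ ((q ∘ id) ⊗₁ (q ∘ m)) ∘ α⇒                ≡⟨ pullˡ (sym (p∘m∘⊗ i id m)) ⟩
    (q ∘ m ∘ (id ⊗₁ m)) ∘ α⇒                       ≡⟨ trans assoc (refl⟩∘⟨ assoc) ⟩
    q ∘ m ∘ (id ⊗₁ m) ∘ α⇒                         ∎

  m-comm : m ∘ γ ≡ m
  m-comm = p-jointly-monic λ i → begin
    p i ∘ m ∘ γ              ≡⟨ pullˡ (⟨⟩-proj _ i) ⟩
    (λ⇒ ∘ (p i ⊗₁ p i)) ∘ γ  ≡⟨ pullʳ (sym γ-natural) ⟩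
    λ⇒ ∘ γ ∘ (p i ⊗₁ p i)    ≡⟨ refl⟩∘⟨ elimˡ γ-unit ⟩
    λ⇒ ∘ (p i ⊗₁ p i)        ≡⟨ sym (⟨⟩-proj _ i) ⟩
    p i ∘ m                  ∎

  m-inj-diag : (i : ℕ) → m ∘ (inj i ⊗₁ inj i) ≡ inj i ∘ λ⇒
  m-inj-diag i = p-jointly-monic λ k → trans (p∘m∘⊗ k _ _) (trans (coordinate k) assoc)
    where
    coordinate : ∀ k → λ⇒ ∘ ((p k ∘ inj i) ⊗₁ (p k ∘ inj i)) ≡ (p k ∘ inj i) ∘ λ⇒
    coordinate k with k ≟ i
    ... | yes refl = trans (refl⟩∘⟨ trans (p∘inj-diag k ⟩⊗⟨ p∘inj-diag k) ⊗-id)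
                           (trans identityʳ (sym (elimˡ (p∘inj-diag k))))
    ... | no k≢i   = trans (refl⟩∘⟨ (p∘inj-offdiag k≢i ⟩⊗⟨ refl)) (trans (refl⟩∘⟨ 𝟎-⊗ˡ)
                           (trans 𝟎-∘ˡ (sym (trans (p∘inj-offdiag k≢i ⟩∘⟨refl) 𝟎-∘ʳ))))

  m-inj-offdiag : {i j : ℕ} → i ≢ j → m ∘ (inj i ⊗₁ inj j) ≡ 𝟎
  m-inj-offdiag {i} {j} i≢j = p-jointly-monic λ k → trans (p∘m∘⊗ k _ _) (trans (coordinate k) (sym 𝟎-∘ˡ))
    where
    coordinate : ∀ k → λ⇒ ∘ ((p k ∘ inj i) ⊗₁ (p k ∘ inj j)) ≡ 𝟎
    coordinate k with k ≟ i
    ... | yes refl = trans (refl⟩∘⟨ (refl ⟩⊗⟨ p∘inj-offdiag i≢j)) (trans (refl⟩∘⟨ 𝟎-⊗ʳ) 𝟎-∘ˡ)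
    ... | no k≢i   = trans (refl⟩∘⟨ (p∘inj-offdiag k≢i ⟩⊗⟨ refl)) (trans (refl⟩∘⟨ 𝟎-⊗ˡ) 𝟎-∘ˡ)

module Comultiplication {o ℓ : Level} (C : SymmetricMonoidalCategory o ℓ) (R : RepresentablyΣAdditive C)
  (c : SymmetricMonoidalCategory.Hom C (RepresentablyΣAdditive.D R)
         (SymmetricMonoidalCategory._⊗₀_ C (RepresentablyΣAdditive.D R) (RepresentablyΣAdditive.D R)))
  (c-spec : RepresentablyΣAdditive.IsComultiplication R c) where
  open RepresentableSums C R
  open ProductMonoid C R
  open ≡-Reasoning

  private variable
    Y : Obj

  inj² : ℕ × ℕ → Hom unit (D ⊗₀ D)
  inj² (a , b) = (inj a ⊗₁ inj b) ∘ λ⇐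

  inj³ : ℕ × ℕ × ℕ → Hom unit (D ⊗₀ (D ⊗₀ D))
  inj³ (a , b , e) = (inj a ⊗₁ (inj b ⊗₁ inj e)) ∘ λ⇐ ∘ λ⇐

  c∘inj-sum : (n : ℕ) → HasSum (λ (x : Antidiagonal n) → inj² (proj₁ x)) (c ∘ inj n)
  c∘inj-sum n with c-spec n
  ... | s , s-sum , c∘inj≡ = subst (HasSum _) (sym c∘inj≡)
    (sum-∘ʳ λ⇐ (sum-reindex Antidiagonal↔Fin
      (λ x → cong (λ y → inj (proj₁ (proj₁ y)) ⊗₁ inj (proj₂ (proj₁ y)))
                  (sym (Inverse.strictlyInverseʳ Antidiagonal↔Fin x)))
      s-sum))

  sum-∘c∘inj : (u : Hom (D ⊗₀ D) Y) (n : ℕ) →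
               HasSum (λ (x : Antidiagonal n) → u ∘ inj² (proj₁ x)) ((u ∘ c) ∘ inj n)
  sum-∘c∘inj u n = subst (HasSum _) (sym assoc) (sum-∘ˡ u (c∘inj-sum n))

  ⊗∘inj² : {Y Y′ : Obj} {f : Hom D Y} {g : Hom D Y′} {a b : ℕ} →
           (f ⊗₁ g) ∘ inj² (a , b) ≡ ((f ∘ inj a) ⊗₁ (g ∘ inj b)) ∘ λ⇐
  ⊗∘inj² = pullˡ (sym ⊗-∘)

  c-counitˡ : (p 0 ⊗₁ id) ∘ c ≡ λ⇐
  c-counitˡ = inj-jointly-epic λ n → begin
    ((p 0 ⊗₁ id) ∘ c) ∘ inj n          ≡⟨ sum-single ((0 , n) , refl) others (sum-∘c∘inj _ n) ⟩
    (p 0 ⊗₁ id) ∘ inj² (0 , n)         ≡⟨ trans ⊗∘inj² ((p∘inj-diag 0 ⟩⊗⟨ identityˡ) ⟩∘⟨refl) ⟩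
    (id ⊗₁ inj n) ∘ λ⇐                 ≡⟨ sym λ⇐-natural ⟩
    λ⇐ ∘ inj n                         ∎
    where
    others : {n : ℕ} (x : Antidiagonal n) → x ≢ ((0 , n) , refl) → (p 0 ⊗₁ id) ∘ inj² (proj₁ x) ≡ 𝟎
    others x x≢ = trans ⊗∘inj²
      (trans ((p∘inj-offdiag (λ 0≡a → x≢ (antidiagonal-ext₁ (sym 0≡a))) ⟩⊗⟨ refl) ⟩∘⟨refl) 𝟎⊗-∘)

  c-counitʳ : (id ⊗₁ p 0) ∘ c ≡ ρ⇐
  c-counitʳ = inj-jointly-epic λ n → begin
    ((id ⊗₁ p 0) ∘ c) ∘ inj n          ≡⟨ sum-single ((n , 0) , +-identityʳ n) others (sum-∘c∘inj _ n) ⟩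
    (id ⊗₁ p 0) ∘ inj² (n , 0)         ≡⟨ trans ⊗∘inj² ((identityˡ ⟩⊗⟨ p∘inj-diag 0) ⟩∘⟨ λ⇐≡ρ⇐) ⟩
    (inj n ⊗₁ id) ∘ ρ⇐                 ≡⟨ sym ρ⇐-natural ⟩
    ρ⇐ ∘ inj n                         ∎
    where
    others : {n : ℕ} (x : Antidiagonal n) → x ≢ ((n , 0) , +-identityʳ n) → (id ⊗₁ p 0) ∘ inj² (proj₁ x) ≡ 𝟎
    others x x≢ = trans ⊗∘inj²
      (trans ((refl ⟩⊗⟨ p∘inj-offdiag (λ 0≡b → x≢ (antidiagonal-ext₂ (sym 0≡b)))) ⟩∘⟨refl) ⊗𝟎-∘)

  c-cocomm : γ ∘ c ≡ c
  c-cocomm = inj-jointly-epic λ n → sum-functional (sum-∘c∘inj γ n)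
    (sum-cong (λ _ → γ∘inj²) (sum-reindex Antidiagonal-swap (λ _ → refl) (c∘inj-sum n)))
    where
    γ∘inj² : {a b : ℕ} → γ ∘ inj² (a , b) ≡ inj² (b , a)
    γ∘inj² = trans (extendʳ γ-natural) (refl⟩∘⟨ elimˡ γ-unit)

  c∘Δ : c ∘ Δ ≡ (Δ ⊗₁ Δ) ∘ λ⇐
  c∘Δ = sum-functional (sum-Σ {f = λ (_ , x) → inj² (proj₁ x)} _ c∘inj-sum (sum-inj c))
          (sum-reindex Σ-Antidiagonal↔ℕ×ℕ (λ _ → refl) (sum-Σ {f = inj²} _ row rows))
    where
    Δ-sum : HasSum inj Δ
    Δ-sum = subst (HasSum _) identityˡ (sum-cong (λ _ → sym identityˡ) (sum-inj id))
    rows : HasSum (λ a → (inj a ⊗₁ Δ) ∘ λ⇐) ((Δ ⊗₁ Δ) ∘ λ⇐)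
    rows = sum-∘ʳ λ⇐ (sum-⊗ˡ Δ Δ-sum)
    row : (a : ℕ) → HasSum (λ b → inj² (a , b)) ((inj a ⊗₁ Δ) ∘ λ⇐)
    row a = sum-∘ʳ λ⇐ (sum-⊗ʳ (inj a) Δ-sum)

  c-coassoc : α⇒ ∘ (c ⊗₁ id) ∘ c ≡ (id ⊗₁ c) ∘ c
  c-coassoc = inj-jointly-epic λ n → trans (sym assoc ⟩∘⟨refl)
    (sum-functional (left n) (sum-reindex Antidiagonal-assoc (λ _ → refl) (right n)))
    where
    left : (n : ℕ) → HasSum (λ ((((_ , e) , _) , ((a , b) , _)) : AntidiagonalSplitˡ n)
                                → inj³ (a , b , e))
                            (((α⇒ ∘ (c ⊗₁ id)) ∘ c) ∘ inj n)
    left n = sum-Σ _ (λ (((i , e) , _)) →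
               subst (HasSum _) (sym (pullʳ (pullˡ (trans (sym ⊗-∘) (refl ⟩⊗⟨ identityˡ)))))
                 (sum-cong (λ _ → sym assoc-inj³) (sum-∘ α⇒ λ⇐ (sum-⊗ˡ (inj e) (c∘inj-sum i)))))
             (sum-∘c∘inj _ n)
      where
      assoc-inj³ : {a b e : ℕ} → α⇒ ∘ (inj² (a , b) ⊗₁ inj e) ∘ λ⇐ ≡ inj³ (a , b , e)
      assoc-inj³ {a} {b} {e} = begin
        α⇒ ∘ (((inj a ⊗₁ inj b) ∘ λ⇐) ⊗₁ inj e) ∘ λ⇐
          ≡⟨ refl⟩∘⟨ trans (refl ⟩⊗⟨ sym identityʳ) ⊗-∘ ⟩∘⟨refl ⟩
        α⇒ ∘ (((inj a ⊗₁ inj b) ⊗₁ inj e) ∘ (λ⇐ ⊗₁ id)) ∘ λ⇐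
          ≡⟨ refl⟩∘⟨ assoc ⟩
        α⇒ ∘ ((inj a ⊗₁ inj b) ⊗₁ inj e) ∘ (λ⇐ ⊗₁ id) ∘ λ⇐
          ≡⟨ extendʳ α-natural ⟩
        (inj a ⊗₁ (inj b ⊗₁ inj e)) ∘ α⇒ ∘ (λ⇐ ⊗₁ id) ∘ λ⇐
          ≡⟨ refl⟩∘⟨ pullˡ α⇒∘λ⇐⊗id ⟩
        (inj a ⊗₁ (inj b ⊗₁ inj e)) ∘ λ⇐ ∘ λ⇐
          ∎
    right : (n : ℕ) → HasSum (λ ((((a , _) , _) , ((b , e) , _)) : AntidiagonalSplitʳ n)
                                 → inj³ (a , b , e))
                             (((id ⊗₁ c) ∘ c) ∘ inj n)
    right n = sum-Σ _ (λ (((a , i) , _)) →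
                subst (HasSum _) (sym (pullˡ (trans (sym ⊗-∘) (identityˡ ⟩⊗⟨ refl))))
                  (sum-cong (λ _ → sym inj⊗inj²) (sum-∘ʳ λ⇐ (sum-⊗ʳ (inj a) (c∘inj-sum i)))))
              (sum-∘c∘inj _ n)
      where
      inj⊗inj² : {a b e : ℕ} → (inj a ⊗₁ inj² (b , e)) ∘ λ⇐ ≡ inj³ (a , b , e)
      inj⊗inj² = trans (trans (sym identityʳ ⟩⊗⟨ refl) ⊗-∘ ⟩∘⟨refl) (pullʳ (sym λ⇐-natural))

  m² : Hom unit (D ⊗₀ D) → Hom unit (D ⊗₀ D) → Hom (unit ⊗₀ unit) (D ⊗₀ D)
  m² x y = ((m ⊗₁ m) ∘ s₂₃) ∘ (x ⊗₁ y)

  m²-inj² : (x y : ℕ × ℕ) → m² (inj² x) (inj² y) ≡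
             ((m ∘ (inj (proj₁ x) ⊗₁ inj (proj₁ y))) ⊗₁ (m ∘ (inj (proj₂ x) ⊗₁ inj (proj₂ y)))) ∘ (λ⇐ ⊗₁ λ⇐)
  m²-inj² (i₁ , i₂) (j₁ , j₂) = begin
    ((m ⊗₁ m) ∘ s₂₃) ∘ (((inj i₁ ⊗₁ inj i₂) ∘ λ⇐) ⊗₁ ((inj j₁ ⊗₁ inj j₂) ∘ λ⇐))
      ≡⟨ pullʳ (refl⟩∘⟨ ⊗-∘) ⟩
    (m ⊗₁ m) ∘ s₂₃ ∘ ((inj i₁ ⊗₁ inj i₂) ⊗₁ (inj j₁ ⊗₁ inj j₂)) ∘ (λ⇐ ⊗₁ λ⇐)
      ≡⟨ refl⟩∘⟨ extendʳ s₂₃-natural ⟩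
    (m ⊗₁ m) ∘ ((inj i₁ ⊗₁ inj j₁) ⊗₁ (inj i₂ ⊗₁ inj j₂)) ∘ s₂₃ ∘ (λ⇐ ⊗₁ λ⇐)
      ≡⟨ refl⟩∘⟨ refl⟩∘⟨ elimˡ s₂₃-unit ⟩
    (m ⊗₁ m) ∘ ((inj i₁ ⊗₁ inj j₁) ⊗₁ (inj i₂ ⊗₁ inj j₂)) ∘ (λ⇐ ⊗₁ λ⇐)
      ≡⟨ pullˡ (sym ⊗-∘) ⟩
    ((m ∘ (inj i₁ ⊗₁ inj j₁)) ⊗₁ (m ∘ (inj i₂ ⊗₁ inj j₂))) ∘ (λ⇐ ⊗₁ λ⇐)
      ∎

  m²-inj²-diag : (x : ℕ × ℕ) → m² (inj² x) (inj² x) ≡ inj² x ∘ λ⇒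
  m²-inj²-diag (a , b) = begin
    m² (inj² (a , b)) (inj² (a , b))
      ≡⟨ m²-inj² (a , b) (a , b) ⟩
    ((m ∘ (inj a ⊗₁ inj a)) ⊗₁ (m ∘ (inj b ⊗₁ inj b))) ∘ (λ⇐ ⊗₁ λ⇐)
      ≡⟨ trans (m-inj-diag a ⟩⊗⟨ m-inj-diag b) ⊗-∘ ⟩∘⟨refl ⟩
    ((inj a ⊗₁ inj b) ∘ (λ⇒ ⊗₁ λ⇒)) ∘ (λ⇐ ⊗₁ λ⇐)
      ≡⟨ cancelʳ (⊗-inverse λ-iso₁ λ-iso₁) ⟩
    inj a ⊗₁ inj b
      ≡⟨ sym (cancelʳ λ-iso₂) ⟩
    inj² (a , b) ∘ λ⇒
      ∎

  m²-inj²-offdiag : {x y : ℕ × ℕ} → x ≢ y → m² (inj² x) (inj² y) ≡ 𝟎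
  m²-inj²-offdiag {x₁ , x₂} {y₁ , y₂} x≢y with x₁ ≟ y₁
  ... | no x₁≢y₁ = trans (m²-inj² _ _) (trans ((m-inj-offdiag x₁≢y₁ ⟩⊗⟨ refl) ⟩∘⟨refl) 𝟎⊗-∘)
  ... | yes refl = trans (m²-inj² _ _)
                     (trans ((refl ⟩⊗⟨ m-inj-offdiag (λ x₂≡y₂ → x≢y (cong (x₁ ,_) x₂≡y₂))) ⟩∘⟨refl) ⊗𝟎-∘)

  c-m : c ∘ m ≡ (m ⊗₁ m) ∘ s₂₃ ∘ (c ⊗₁ c)
  c-m = inj⊗inj-jointly-epic λ a b →
    trans (on-basis a b (a ≟ b)) (sym (trans (pullʳ (pullʳ (sym ⊗-∘))) (sym assoc)))
    where
    m²-sum : (a b : ℕ) →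
             HasSum (λ (x : Antidiagonal a) → m² (inj² (proj₁ x)) (c ∘ inj b)) (m² (c ∘ inj a) (c ∘ inj b))
    m²-sum a b = sum-∘ˡ _ (sum-⊗ˡ (c ∘ inj b) (c∘inj-sum a))

    row-sum : (x : ℕ × ℕ) (b : ℕ) →
              HasSum (λ (y : Antidiagonal b) → m² (inj² x) (inj² (proj₁ y))) (m² (inj² x) (c ∘ inj b))
    row-sum x b = sum-∘ˡ _ (sum-⊗ʳ (inj² x) (c∘inj-sum b))

    on-basis : (a b : ℕ) → Dec (a ≡ b) → (c ∘ m) ∘ (inj a ⊗₁ inj b) ≡ m² (c ∘ inj a) (c ∘ inj b)
    on-basis a .a (yes refl) = trans (pullʳ (m-inj-diag a)) (trans (sym assoc)
      (sum-functional (sum-∘ʳ λ⇒ (c∘inj-sum a)) (sum-cong (λ x → sym (row-diag x)) (m²-sum a a))))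
      where
      row-diag : (x : Antidiagonal a) → m² (inj² (proj₁ x)) (c ∘ inj a) ≡ inj² (proj₁ x) ∘ λ⇒
      row-diag x = trans
        (sum-single x (λ y y≢x → m²-inj²-offdiag (λ x≡y → y≢x (antidiagonal-ext₁ (sym (cong proj₁ x≡y)))))
                    (row-sum (proj₁ x) a))
        (m²-inj²-diag (proj₁ x))
    on-basis a b (no a≢b) = trans (pullʳ (m-inj-offdiag a≢b)) (trans 𝟎-∘ˡ (sym
      (sum-zero (λ x → sum-zero (λ y → m²-inj²-offdiag (antidiagonal-disjoint a≢b x y)) (row-sum (proj₁ x) b))
                (m²-sum a b))))

mainTheorem12 : {o ℓ : Level} (C : SymmetricMonoidalCategory o ℓ)
    (R : RepresentablyΣAdditive C)
    (c : SymmetricMonoidalCategory.Hom C (RepresentablyΣAdditive.D R)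
           (SymmetricMonoidalCategory._⊗₀_ C (RepresentablyΣAdditive.D R)
              (RepresentablyΣAdditive.D R))) →
    RepresentablyΣAdditive.IsComultiplication R c →
    IsBicommutativeBimonoid C (RepresentablyΣAdditive.D R)
      (RepresentablyΣAdditive.Δ R) (RepresentablyΣAdditive.m R)
      (RepresentablyΣAdditive.p R 0) c
mainTheorem12 C R c c-spec = record
  { μ-unitˡ   = m-unitˡ
  ; μ-unitʳ   = m-unitʳ
  ; μ-assoc   = m-assoc
  ; μ-comm    = m-comm
  ; ν-counitˡ = c-counitˡ
  ; ν-counitʳ = c-counitʳ
  ; ν-coassoc = c-coassoc
  ; ν-cocomm  = c-cocomm
  ; ε-η       = p∘Δ 0
  ; ν-η       = c∘Δ
  ; ε-μ       = ⟨⟩-proj _ 0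
  ; ν-μ       = c-m
  }
  where
  open RepresentableSums C R using (p∘Δ; ⟨⟩-proj)
  open ProductMonoid C R
  open Comultiplication C R c c-spec
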